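{- For integers $n\ge 3$, $$M^{[2]}(2,n)=\begin{cases}\infty & \text{if } n=3,\\ 5 & \text{if } n=4,\\ \left\lfloor\frac{n}{2}\right\rfloor+2 & \text{if } n\ge 5.\end{cases}$$
   Context: Group testing setting: a population of $n$ items contains exactly $d$ defective items, where $d$ is known in advance. A test is applied to a subset of the population and its outcome is positive if the subset contains at least one defective item and negative otherwise. Tests are performed sequentially (adaptively): the result of each test is known before the next test is chosen. An algorithm solves the $(d,n)$-problem if it always identifies the set of defective items. $M^{[k]}(d,n)$ denotes the minimum, over all such sequential algorithms in which every tested subset has size exactly $k$, of the worst-case number of tests used; if no such algorithm exists, $M^{[k]}(d,n)=\infty$. -}

module Defs where

open import Data.Nat using (ℕ; zero; suc; _≤_)
open import Data.Bool using (Bool; true; false)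
open import Data.Product using (Σ; _×_; _,_; proj₁; proj₂)
open import Data.Fin.Subset using (Subset; _∩_; ∣_∣; Nonempty)
open import Data.Fin.Subset.Properties using (nonempty?)
open import Relation.Nullary using (¬_; does)
open import Relation.Binary.PropositionalEquality using (_≡_)

outcome : ∀ {n} → Subset n → Subset n → Bool
outcome T D = does (nonempty? (T ∩ D))

-- A sequential (adaptive) group testing algorithm on n items, as a
-- decision tree: either stop and output a set, or test a set T and
-- continue with the positive-branch or the negative-branch subtree.
data Algorithm (n : ℕ) : Set where
  output : Subset n → Algorithm n
  test   : Subset n → Algorithm n → Algorithm n → Algorithm n

run : ∀ {n} → Algorithm n → Subset n → Subset n × ℕ
run (output S) D = S , 0
run (test T pos neg) D with outcome T D
... | true  = let r = run pos D in proj₁ r , suc (proj₂ r)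
... | false = let r = run neg D in proj₁ r , suc (proj₂ r)

data TestSize {n : ℕ} (k : ℕ) : Algorithm n → Set where
  output : ∀ S → TestSize k (output S)
  test   : ∀ {T pos neg} → ∣ T ∣ ≡ k → TestSize k pos → TestSize k neg
         → TestSize k (test T pos neg)

Solves : ∀ {n} → ℕ → Algorithm n → Set
Solves {n} d A = ∀ (D : Subset n) → ∣ D ∣ ≡ d → proj₁ (run A D) ≡ D

UsesAtMost : ∀ {n} → ℕ → Algorithm n → ℕ → Set
UsesAtMost {n} d A m = ∀ (D : Subset n) → ∣ D ∣ ≡ d → proj₂ (run A D) ≤ m

data ℕ∞ : Set where
  fin : ℕ → ℕ∞
  ∞   : ℕ∞

IsM : (k d n : ℕ) → ℕ∞ → Set
IsM k d n ∞ = ∀ (A : Algorithm n) → TestSize k A → ¬ Solves d A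
IsM k d n (fin m) =
  Σ (Algorithm n) (λ A → TestSize k A × Solves d A × UsesAtMost d A m)
  × (∀ (A : Algorithm n) (m' : ℕ) → TestSize k A → Solves d A → UsesAtMost d A m' → m ≤ m')

module Submission where

-- For n = 3 every 2-test meets every 2-set, so no test separates {0,1} from {0,2}.
-- For n = 4 a positive answer to a 2-test excludes only the complementary pair: an
-- adversary answering positively keeps two of the six pairs alive through four tests,
-- while testing five pairs in turn suffices.
-- For n ≥ 5 the algorithm tests disjoint pairs; after the first positive pair {a , b}
-- the defective outside {a , b} is located two items per test, and the final choices
-- use an item already known to be good, for ⌊n/2⌋ + 2 tests in all.  The matching lower
-- bound is an adversary argument: the consistent pairs always form one of four shapes
-- (all pairs inside a set, a star, a fan around a pair, a 2×2 grid), and a potential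
-- depending only on the shape and its size drops by at most one per answer, starting
-- from ⌊n/2⌋ + 2.

open import Defs
open import Data.Bool as Bool using (Bool; true; false; if_then_else_)
open import Data.Empty using (⊥-elim)
open import Data.Fin using (Fin; zero; suc; _≟_; opposite; inject₁)
open import Data.Fin.Properties using (all?)
open import Data.Fin.Subset
  using (Subset; _∈_; _∉_; _⊆_; _∪_; _∩_; ⁅_⁆; ∣_∣; Nonempty; inside; outside; ⊤)
open import Data.Fin.Subset.Properties
  using (x∈⁅x⁆; x∈⁅y⁆⇒x≡y; x∈p∪q⁺; x∈p∪q⁻; x∈p∩q⁺; x∈p∩q⁻; ∪-comm; ∪-identityʳ; ∣⁅x⁆∣≡1; ∣⊤∣≡n;
         ⊆-antisym; nonempty?; _∈?_)
open import Data.List as List using (List; []; _∷_; foldr; allFin; length)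
open import Data.List.Membership.Propositional using () renaming (_∈_ to _∈ₗ_)
open import Data.List.Membership.Propositional.Properties using (∈-allFin)
open import Data.List.Properties using (length-tabulate)
open import Data.List.Relation.Unary.All as All using (All; []; _∷_)
open import Data.List.Relation.Unary.AllPairs using ([]; _∷_)
open import Data.List.Relation.Unary.Any using (here; there)
open import Data.List.Relation.Unary.Unique.Propositional using (Unique)
open import Data.List.Relation.Unary.Unique.Propositional.Properties using (allFin⁺)
open import Data.Nat using (ℕ; zero; suc; _≤_; _<_; _+_; _∸_; _/_; ⌊_/2⌋; ⌈_/2⌉; z≤n; s≤s; _≤?_)
open import Data.Nat.DivMod using (m/n≡1+[m∸n]/n)
open import Data.Nat.Properties as ℕ using (≤-refl; ≤-trans; m≤n⇒m≤1+n)
open import Data.Product using (Σ; ∃; ∃₂; _×_; _,_; proj₁; proj₂; map₂)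
open import Data.Sum as Sum using (_⊎_; inj₁; inj₂; [_,_]; [_,_]′)
open import Data.Vec using ([]; _∷_)
open import Data.Vec.Base using (here; there)
open import Data.Vec.Properties using (≡-dec)
open import Function using (id; _∘_)
open import Relation.Nullary using (Dec; yes; no)
open import Relation.Nullary.Decidable using (dec-true; dec-false; toWitness; _⊎-dec_; _→-dec_)
open import Relation.Binary.PropositionalEquality
  using (_≡_; _≢_; refl; sym; trans; cong; subst; subst₂; ≢-sym; module ≡-Reasoning)

module _ {n : ℕ} where

  pair : Fin n → Fin n → Subset n
  pair x y = ⁅ x ⁆ ∪ ⁅ y ⁆

  x∈pair : (x y : Fin n) → x ∈ pair x y
  x∈pair x y = x∈p∪q⁺ (inj₁ (x∈⁅x⁆ x))

  y∈pair : (x y : Fin n) → y ∈ pair x y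
  y∈pair x y = x∈p∪q⁺ (inj₂ (x∈⁅x⁆ y))

  ∈pair⁻ : ∀ {x y z : Fin n} → z ∈ pair x y → z ≡ x ⊎ z ≡ y
  ∈pair⁻ {x} {y} z∈ with x∈p∪q⁻ ⁅ x ⁆ ⁅ y ⁆ z∈
  ... | inj₁ z∈x = inj₁ (x∈⁅y⁆⇒x≡y x z∈x)
  ... | inj₂ z∈y = inj₂ (x∈⁅y⁆⇒x≡y y z∈y)

  ∉pair : ∀ {x y z : Fin n} → z ≢ x → z ≢ y → z ∉ pair x y
  ∉pair z≢x z≢y z∈ = [ z≢x , z≢y ] (∈pair⁻ z∈)

  pair-comm : (x y : Fin n) → pair x y ≡ pair y x
  pair-comm x y = ∪-comm ⁅ x ⁆ ⁅ y ⁆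

  pair-≡ : ∀ {a b x y : Fin n} → x ≢ y → x ≡ a ⊎ x ≡ b → y ≡ a ⊎ y ≡ b → pair a b ≡ pair x y
  pair-≡ x≢y (inj₁ refl) (inj₁ refl) = ⊥-elim (x≢y refl)
  pair-≡ x≢y (inj₁ refl) (inj₂ refl) = refl
  pair-≡ x≢y (inj₂ refl) (inj₁ refl) = pair-comm _ _
  pair-≡ x≢y (inj₂ refl) (inj₂ refl) = ⊥-elim (x≢y refl)

  pair-≢ : ∀ {x y x′ z : Fin n} → z ≢ x → z ≢ y → pair x y ≢ pair x′ z
  pair-≢ z≢x z≢y e = ∉pair z≢x z≢y (subst (_ ∈_) (sym e) (y∈pair _ _))

∣p∪⁅x⁆∣≡1+∣p∣ : ∀ {n} (p : Subset n) {x : Fin n} → x ∉ p → ∣ p ∪ ⁅ x ⁆ ∣ ≡ suc ∣ p ∣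
∣p∪⁅x⁆∣≡1+∣p∣ (inside ∷ p) {zero} x∉p = ⊥-elim (x∉p here)
∣p∪⁅x⁆∣≡1+∣p∣ (outside ∷ p) {zero} x∉p rewrite ∪-identityʳ p = refl
∣p∪⁅x⁆∣≡1+∣p∣ (inside ∷ p) {suc x} x∉p = cong suc (∣p∪⁅x⁆∣≡1+∣p∣ p (λ x∈p → x∉p (there x∈p)))
∣p∪⁅x⁆∣≡1+∣p∣ (outside ∷ p) {suc x} x∉p = ∣p∪⁅x⁆∣≡1+∣p∣ p (λ x∈p → x∉p (there x∈p))

∣pair∣≡2 : ∀ {n} {x y : Fin n} → x ≢ y → ∣ pair x y ∣ ≡ 2
∣pair∣≡2 {x = x} {y} x≢y =
  trans (∣p∪⁅x⁆∣≡1+∣p∣ ⁅ x ⁆ (λ y∈x → x≢y (sym (x∈⁅y⁆⇒x≡y x y∈x)))) (cong suc (∣⁅x⁆∣≡1 x))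

-- The library's `_-_` is defined through a `where`-bound helper, which blocks the
-- structural reasoning about cardinalities below.
infixl 5 _∖_
_∖_ : ∀ {n} → Subset n → Fin n → Subset n
(s ∷ p) ∖ zero  = outside ∷ p
(s ∷ p) ∖ suc x = s ∷ (p ∖ x)

∣p∣≤1+∣p∖x∣ : ∀ {n} (p : Subset n) (x : Fin n) → ∣ p ∣ ≤ suc ∣ p ∖ x ∣
∣p∣≤1+∣p∖x∣ (inside ∷ p) zero = ≤-refl
∣p∣≤1+∣p∖x∣ (outside ∷ p) zero = m≤n⇒m≤1+n ≤-refl
∣p∣≤1+∣p∖x∣ (inside ∷ p) (suc x) = s≤s (∣p∣≤1+∣p∖x∣ p x)
∣p∣≤1+∣p∖x∣ (outside ∷ p) (suc x) = ∣p∣≤1+∣p∖x∣ p x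

x∈p⇒1+∣p∖x∣≡∣p∣ : ∀ {n} {p : Subset n} {x : Fin n} → x ∈ p → suc ∣ p ∖ x ∣ ≡ ∣ p ∣
x∈p⇒1+∣p∖x∣≡∣p∣ {p = inside ∷ p} here = refl
x∈p⇒1+∣p∖x∣≡∣p∣ {p = inside ∷ p} (there x∈p) = cong suc (x∈p⇒1+∣p∖x∣≡∣p∣ x∈p)
x∈p⇒1+∣p∖x∣≡∣p∣ {p = outside ∷ p} (there x∈p) = x∈p⇒1+∣p∖x∣≡∣p∣ x∈p

y∈p∖x⇒y∈p : ∀ {n} {p : Subset n} {x y : Fin n} → y ∈ p ∖ x → y ∈ p
y∈p∖x⇒y∈p {p = _ ∷ p} {zero} (there y∈) = there y∈
y∈p∖x⇒y∈p {p = _ ∷ p} {suc x} here = here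
y∈p∖x⇒y∈p {p = _ ∷ p} {suc x} (there y∈) = there (y∈p∖x⇒y∈p y∈)

y∈p∖x⇒y≢x : ∀ {n} {p : Subset n} {x y : Fin n} → y ∈ p ∖ x → y ≢ x
y∈p∖x⇒y≢x {p = _ ∷ p} {zero} (there _) ()
y∈p∖x⇒y≢x {p = _ ∷ p} {suc x} (there y∈) refl = y∈p∖x⇒y≢x y∈ refl

x∉p∖x : ∀ {n} (p : Subset n) (x : Fin n) → x ∉ p ∖ x
x∉p∖x p x x∈ = y∈p∖x⇒y≢x {p = p} x∈ refl

y∈p∧y≢x⇒y∈p∖x : ∀ {n} {p : Subset n} {x y : Fin n} → y ∈ p → y ≢ x → y ∈ p ∖ x
y∈p∧y≢x⇒y∈p∖x {x = zero} {zero} _ y≢x = ⊥-elim (y≢x refl)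
y∈p∧y≢x⇒y∈p∖x {x = zero} {suc y} (there y∈p) _ = there y∈p
y∈p∧y≢x⇒y∈p∖x {x = suc x} {zero} here _ = here
y∈p∧y≢x⇒y∈p∖x {x = suc x} {suc y} (there y∈p) y≢x = there (y∈p∧y≢x⇒y∈p∖x y∈p (λ e → y≢x (cong suc e)))

2+∣p∖x∖y∣≡∣p∣ : ∀ {n} {p : Subset n} {x y} → x ∈ p → y ∈ p → x ≢ y → suc (suc ∣ p ∖ x ∖ y ∣) ≡ ∣ p ∣
2+∣p∖x∖y∣≡∣p∣ x∈p y∈p x≢y =
  trans (cong suc (x∈p⇒1+∣p∖x∣≡∣p∣ (y∈p∧y≢x⇒y∈p∖x y∈p (≢-sym x≢y)))) (x∈p⇒1+∣p∖x∣≡∣p∣ x∈p)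

there-Nonempty : ∀ {n s} {p : Subset n} → Nonempty p → Nonempty (s ∷ p)
there-Nonempty (x , x∈p) = suc x , there x∈p

∣p∣>0⇒Nonempty : ∀ {n} (p : Subset n) → 1 ≤ ∣ p ∣ → Nonempty p
∣p∣>0⇒Nonempty (inside ∷ p) _ = zero , here
∣p∣>0⇒Nonempty (outside ∷ p) 1≤∣p∣ = there-Nonempty (∣p∣>0⇒Nonempty p 1≤∣p∣)

k<∣p∣⇒k≤∣p∖x∣ : ∀ {n k} {p : Subset n} {x : Fin n} → x ∈ p → suc k ≤ ∣ p ∣ → k ≤ ∣ p ∖ x ∣
k<∣p∣⇒k≤∣p∖x∣ x∈p k<∣p∣ rewrite sym (x∈p⇒1+∣p∖x∣≡∣p∣ x∈p) = ℕ.≤-pred k<∣p∣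

two-members : ∀ {n} (p : Subset n) → 2 ≤ ∣ p ∣ → ∃₂ λ x y → x ≢ y × x ∈ p × y ∈ p
two-members p 2≤∣p∣ with ∣p∣>0⇒Nonempty p (≤-trans (s≤s z≤n) 2≤∣p∣)
... | x , x∈p with ∣p∣>0⇒Nonempty (p ∖ x) (k<∣p∣⇒k≤∣p∖x∣ x∈p 2≤∣p∣)
... | y , y∈p∖x = x , y , ≢-sym (y∈p∖x⇒y≢x y∈p∖x) , x∈p , y∈p∖x⇒y∈p y∈p∖x

∣p∣≡2⇒pair : ∀ {n} (D : Subset n) → ∣ D ∣ ≡ 2 → ∃₂ λ x y → x ≢ y × D ≡ pair x y
∣p∣≡2⇒pair D ∣D∣≡2 with two-members D (subst (2 ≤_) (sym ∣D∣≡2) ≤-refl)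
... | x , y , x≢y , x∈D , y∈D = x , y , x≢y , ⊆-antisym D⊆pair pair⊆D
  where
  D⊆pair : D ⊆ pair x y
  D⊆pair {z} z∈D with z ≟ x | z ≟ y
  ... | yes refl | _ = x∈pair x y
  ... | no _ | yes refl = y∈pair x y
  ... | no z≢x | no z≢y
    with trans (cong (λ k → suc (suc k)) (x∈p⇒1+∣p∖x∣≡∣p∣ z∈D∖x∖y))
               (trans (2+∣p∖x∖y∣≡∣p∣ x∈D y∈D x≢y) ∣D∣≡2)
    where z∈D∖x∖y = y∈p∧y≢x⇒y∈p∖x (y∈p∧y≢x⇒y∈p∖x z∈D z≢x) z≢y
  ... | ()
  pair⊆D : pair x y ⊆ D
  pair⊆D z∈ = [ (λ { refl → x∈D }) , (λ { refl → y∈D }) ] (∈pair⁻ z∈)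

module _ {n : ℕ} {T D : Subset n} where

  outcome≡true : ∀ {x} → x ∈ T → x ∈ D → outcome T D ≡ true
  outcome≡true {x} x∈T x∈D = dec-true (nonempty? (T ∩ D)) (x , x∈p∩q⁺ (x∈T , x∈D))

  outcome≡false : (∀ {x} → x ∈ T → x ∉ D) → outcome T D ≡ false
  outcome≡false disjoint = dec-false (nonempty? (T ∩ D)) λ (x , x∈T∩D) →
    let x∈T , x∈D = x∈p∩q⁻ T D x∈T∩D in disjoint x∈T x∈D

module _ {n : ℕ} {T : Subset n} {x y : Fin n} where

  outcome-pair≡true : x ∈ T ⊎ y ∈ T → outcome T (pair x y) ≡ true
  outcome-pair≡true (inj₁ x∈T) = outcome≡true x∈T (x∈pair x y)
  outcome-pair≡true (inj₂ y∈T) = outcome≡true y∈T (y∈pair x y)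

  outcome-pair≡false : x ∉ T → y ∉ T → outcome T (pair x y) ≡ false
  outcome-pair≡false x∉T y∉T = outcome≡false {D = pair x y} λ z∈T z∈pair →
    [ (λ { refl → x∉T z∈T }) , (λ { refl → y∉T z∈T }) ] (∈pair⁻ z∈pair)

run-test : ∀ {n} {T D : Subset n} {b} (p q : Algorithm n) → outcome T D ≡ b →
           run (test T p q) D ≡ map₂ suc (run (if b then p else q) D)
run-test {T = T} {D} p q e with outcome T D
run-test p q refl | true = refl
run-test p q refl | false = refl

same-outcomes⇒same-output : ∀ {n k} {D D′ : Subset n} →
  (∀ T → ∣ T ∣ ≡ k → outcome T D ≡ outcome T D′) →
  ∀ (A : Algorithm n) → TestSize k A → proj₁ (run A D) ≡ proj₁ (run A D′)
same-outcomes⇒same-output same (output S) _ = refl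
same-outcomes⇒same-output {D = D} {D′} same (test T p q) (test ∣T∣≡k tp tq)
  with outcome T D | same T ∣T∣≡k
... | true  | same-at-T rewrite sym same-at-T = same-outcomes⇒same-output same p tp
... | false | same-at-T rewrite sym same-at-T = same-outcomes⇒same-output same q tq

n<∣p∣+∣q∣⇒Nonempty[p∩q] : ∀ {n} (p q : Subset n) → n < ∣ p ∣ + ∣ q ∣ → Nonempty (p ∩ q)
n<∣p∣+∣q∣⇒Nonempty[p∩q] [] [] ()
n<∣p∣+∣q∣⇒Nonempty[p∩q] (inside ∷ p) (inside ∷ q) _ = zero , here
n<∣p∣+∣q∣⇒Nonempty[p∩q] (inside ∷ p) (outside ∷ q) (s≤s n<) =
  there-Nonempty (n<∣p∣+∣q∣⇒Nonempty[p∩q] p q n<)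
n<∣p∣+∣q∣⇒Nonempty[p∩q] (outside ∷ p) (inside ∷ q) n< rewrite ℕ.+-suc ∣ p ∣ ∣ q ∣ =
  there-Nonempty (n<∣p∣+∣q∣⇒Nonempty[p∩q] p q (ℕ.≤-pred n<))
n<∣p∣+∣q∣⇒Nonempty[p∩q] (outside ∷ p) (outside ∷ q) n< =
  there-Nonempty (n<∣p∣+∣q∣⇒Nonempty[p∩q] p q (ℕ.<-trans (ℕ.n<1+n _) n<))

n<∣T∣+∣D∣⇒outcome≡true : ∀ {n} (T D : Subset n) → n < ∣ T ∣ + ∣ D ∣ → outcome T D ≡ true
n<∣T∣+∣D∣⇒outcome≡true T D n< = dec-true (nonempty? (T ∩ D)) (n<∣p∣+∣q∣⇒Nonempty[p∩q] T D n<)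

M[2,2,3]≡∞ : IsM 2 2 3 ∞
M[2,2,3]≡∞ A size-2 solves = D≢D′ (begin
  D                  ≡⟨ solves D refl ⟨
  proj₁ (run A D)    ≡⟨ same-outcomes⇒same-output always-positive A size-2 ⟩
  proj₁ (run A D′)   ≡⟨ solves D′ refl ⟩
  D′                 ∎)
  where
  open ≡-Reasoning
  D D′ : Subset 3
  D  = inside ∷ inside ∷ outside ∷ []
  D′ = inside ∷ outside ∷ inside ∷ []
  D≢D′ : D ≢ D′
  D≢D′ ()
  positive : ∀ (T E : Subset 3) → ∣ T ∣ ≡ 2 → ∣ E ∣ ≡ 2 → outcome T E ≡ true
  positive T E ∣T∣≡2 ∣E∣≡2 =
    n<∣T∣+∣D∣⇒outcome≡true T E (subst₂ (λ t e → 3 < t + e) (sym ∣T∣≡2) (sym ∣E∣≡2) ≤-refl)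
  always-positive : ∀ T → ∣ T ∣ ≡ 2 → outcome T D ≡ outcome T D′
  always-positive T ∣T∣≡2 = trans (positive T D ∣T∣≡2 refl) (sym (positive T D′ ∣T∣≡2 refl))

-- A state stands for the d-sets still consistent with the answers given so far.
record Adversary (n k d : ℕ) : Set₁ where
  field
    State       : Set
    _admits_    : State → Subset n → Set
    potential   : State → ℕ
    admits-size : ∀ {s D} → s admits D → ∣ D ∣ ≡ d
    two-admitted : ∀ s → 1 ≤ potential s → ∃₂ λ D D′ → s admits D × s admits D′ × D ≢ D′
    answer      : ∀ s T → ∣ T ∣ ≡ k → Σ Bool λ b → Σ State λ s′ →
                  potential s ≤ suc (potential s′) × (∀ {D} → s′ admits D → s admits D × outcome T D ≡ b)

module _ {n k d : ℕ} (adv : Adversary n k d) where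

  open Adversary adv

  1≤cost-test : ∀ T (p q : Algorithm n) D → 1 ≤ proj₂ (run (test T p q) D)
  1≤cost-test T p q D rewrite run-test {T = T} {D} p q refl = s≤s z≤n

  Forces : Algorithm n → Set
  Forces A = ∀ s → (∀ {D} → s admits D → proj₁ (run A D) ≡ D) → 1 ≤ potential s →
             ∃ λ D → s admits D × potential s ≤ proj₂ (run A D)

  Forces-if : ∀ b {p q} → Forces p → Forces q → Forces (if b then p else q)
  Forces-if true fp _ = fp
  Forces-if false _ fq = fq

  Forces-test : ∀ {T} p q → ∣ T ∣ ≡ k → Forces p → Forces q → Forces (test T p q)
  Forces-test {T} p q ∣T∣≡k fp fq s correct 1≤pot with answer s T ∣T∣≡k
  ... | b , s′ , pot≤ , back with 1 ≤? potential s′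
  ...   | no pot′≱1 = let D , _ , sD , _ = two-admitted s 1≤pot in
                      D , sD , ≤-trans pot≤ (≤-trans (ℕ.≰⇒> pot′≱1) (1≤cost-test T p q D))
  ...   | yes 1≤pot′ with Forces-if b fp fq s′ correct′ 1≤pot′
    where
    correct′ : ∀ {D} → s′ admits D → proj₁ (run (if b then p else q) D) ≡ D
    correct′ s′D =
      trans (cong proj₁ (sym (run-test p q (proj₂ (back s′D))))) (correct (proj₁ (back s′D)))
  ... | D , s′D , pot′≤cost = D , proj₁ (back s′D) , (begin
    potential s                                        ≤⟨ pot≤ ⟩
    suc (potential s′)                                 ≤⟨ s≤s pot′≤cost ⟩
    suc (proj₂ (run (if b then p else q) D))           ≡⟨ cong proj₂ (run-test p q (proj₂ (back s′D))) ⟨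
    proj₂ (run (test T p q) D)                         ∎)
    where open ℕ.≤-Reasoning

  adversary-forces : ∀ (A : Algorithm n) → TestSize k A → Forces A
  adversary-forces (output S) _ s correct 1≤pot with two-admitted s 1≤pot
  ... | D , D′ , sD , sD′ , D≢D′ = ⊥-elim (D≢D′ (trans (sym (correct sD)) (correct sD′)))
  adversary-forces (test T p q) (test ∣T∣≡k tp tq) =
    Forces-test p q ∣T∣≡k (adversary-forces p tp) (adversary-forces q tq)

  adversary-lower-bound : ∀ (A : Algorithm n) {m} → TestSize k A → Solves d A → UsesAtMost d A m →
                          ∀ s → 1 ≤ potential s → potential s ≤ m
  adversary-lower-bound A size-k solves uses s 1≤pot
    with adversary-forces A size-k s (λ sD → solves _ (admits-size sD)) 1≤pot
  ... | D , sD , pot≤cost = ≤-trans pot≤cost (uses D (admits-size sD))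

_≟ₛ_ : ∀ {n} (p q : Subset n) → Dec (p ≡ q)
_≟ₛ_ = ≡-dec Bool._≟_

-- The six 2-subsets of a 4-set, numbered so that `opposite i` numbers the complement of i.
pairs₄ : Fin 6 → Subset 4
pairs₄ zero                          = inside  ∷ inside  ∷ outside ∷ outside ∷ []
pairs₄ (suc zero)                    = inside  ∷ outside ∷ inside  ∷ outside ∷ []
pairs₄ (suc (suc zero))              = inside  ∷ outside ∷ outside ∷ inside  ∷ []
pairs₄ (suc (suc (suc zero)))        = outside ∷ inside  ∷ inside  ∷ outside ∷ []
pairs₄ (suc (suc (suc (suc zero))))  = outside ∷ inside  ∷ outside ∷ inside  ∷ []
pairs₄ (suc (suc (suc (suc (suc zero))))) = outside ∷ outside ∷ inside ∷ inside ∷ []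

∣pairs₄∣≡2 : ∀ i → ∣ pairs₄ i ∣ ≡ 2
∣pairs₄∣≡2 = toWitness {a? = all? λ i → ∣ pairs₄ i ∣ ℕ.≟ 2} _

pairs₄-injective : ∀ i j → pairs₄ i ≡ pairs₄ j → i ≡ j
pairs₄-injective = toWitness {a? = all? λ i → all? λ j → (pairs₄ i ≟ₛ pairs₄ j) →-dec (i ≟ j)} _

pairs₄-meet : ∀ i j → j ≡ opposite i ⊎ outcome (pairs₄ i) (pairs₄ j) ≡ true
pairs₄-meet = toWitness {a? = all? λ i → all? λ j →
  (j ≟ opposite i) ⊎-dec (outcome (pairs₄ i) (pairs₄ j) Bool.≟ true)} _

pairs₄-surjective : ∀ (D : Subset 4) → ∣ D ∣ ≡ 2 → ∃ λ i → D ≡ pairs₄ i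
pairs₄-surjective (inside  ∷ inside  ∷ outside ∷ outside ∷ []) _ = zero , refl
pairs₄-surjective (inside  ∷ outside ∷ inside  ∷ outside ∷ []) _ = suc zero , refl
pairs₄-surjective (inside  ∷ outside ∷ outside ∷ inside  ∷ []) _ = suc (suc zero) , refl
pairs₄-surjective (outside ∷ inside  ∷ inside  ∷ outside ∷ []) _ = suc (suc (suc zero)) , refl
pairs₄-surjective (outside ∷ inside  ∷ outside ∷ inside  ∷ []) _ = suc (suc (suc (suc zero))) , refl
pairs₄-surjective (outside ∷ outside ∷ inside  ∷ inside  ∷ []) _ = suc (suc (suc (suc (suc zero)))) , refl
pairs₄-surjective (inside  ∷ inside  ∷ inside  ∷ inside  ∷ []) ()
pairs₄-surjective (inside  ∷ inside  ∷ inside  ∷ outside ∷ []) ()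
pairs₄-surjective (inside  ∷ inside  ∷ outside ∷ inside  ∷ []) ()
pairs₄-surjective (inside  ∷ outside ∷ inside  ∷ inside  ∷ []) ()
pairs₄-surjective (outside ∷ inside  ∷ inside  ∷ inside  ∷ []) ()
pairs₄-surjective (inside  ∷ outside ∷ outside ∷ outside ∷ []) ()
pairs₄-surjective (outside ∷ inside  ∷ outside ∷ outside ∷ []) ()
pairs₄-surjective (outside ∷ outside ∷ inside  ∷ outside ∷ []) ()
pairs₄-surjective (outside ∷ outside ∷ outside ∷ inside  ∷ []) ()
pairs₄-surjective (outside ∷ outside ∷ outside ∷ outside ∷ []) ()

-- Test five of the six pairs in turn; a negative answer reveals the complement.
search₄ : Algorithm 4
search₄ = foldr (λ i rest → test (pairs₄ i) rest (output (pairs₄ (opposite i))))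
                (output (pairs₄ zero)) (List.map inject₁ (allFin 5))

search₄-size : TestSize 2 search₄
search₄-size = test refl (test refl (test refl (test refl (test refl
                 (output _) (output _)) (output _)) (output _)) (output _)) (output _)

search₄-solves : Solves 2 search₄
search₄-solves D ∣D∣≡2 with pairs₄-surjective D ∣D∣≡2
... | i , refl = toWitness {a? = all? λ i → proj₁ (run search₄ (pairs₄ i)) ≟ₛ pairs₄ i} _ i

search₄-uses : UsesAtMost 2 search₄ 5
search₄-uses D ∣D∣≡2 with pairs₄-surjective D ∣D∣≡2
... | i , refl = toWitness {a? = all? λ i → proj₂ (run search₄ (pairs₄ i)) ≤? 5} _ i

-- Answering every test positively rules out only the complement of the tested pair.
adversary₄ : Adversary 4 2 2
adversary₄ = record
  { State        = Subset 6
  ; _admits_     = λ s D → ∃ λ i → i ∈ s × D ≡ pairs₄ i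
  ; potential    = λ s → ∣ s ∣ ∸ 1
  ; admits-size  = λ { (i , _ , refl) → ∣pairs₄∣≡2 i }
  ; two-admitted = two-admitted
  ; answer       = answer
  }
  where
  two-admitted : ∀ s → 1 ≤ ∣ s ∣ ∸ 1 → ∃₂ λ D D′ →
    (∃ λ i → i ∈ s × D ≡ pairs₄ i) × (∃ λ i → i ∈ s × D′ ≡ pairs₄ i) × D ≢ D′
  two-admitted s 1≤∣s∣∸1 with two-members s (ℕ.m∸n≢0⇒n<m λ e → ℕ.<⇒≢ 1≤∣s∣∸1 (sym e))
  ... | i , j , i≢j , i∈s , j∈s =
    pairs₄ i , pairs₄ j , (i , i∈s , refl) , (j , j∈s , refl) , λ e → i≢j (pairs₄-injective i j e)
  answer : ∀ s T → ∣ T ∣ ≡ 2 → Σ Bool λ b → Σ (Subset 6) λ s′ →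
    ∣ s ∣ ∸ 1 ≤ suc (∣ s′ ∣ ∸ 1) ×
    (∀ {D} → (∃ λ i → i ∈ s′ × D ≡ pairs₄ i) → (∃ λ i → i ∈ s × D ≡ pairs₄ i) × outcome T D ≡ b)
  answer s T ∣T∣≡2 with pairs₄-surjective T ∣T∣≡2
  ... | t , refl = true , s ∖ opposite t ,
    ≤-trans (ℕ.∸-monoˡ-≤ 1 (∣p∣≤1+∣p∖x∣ s (opposite t))) (ℕ.m≤n+m∸n _ 1) ,
    λ { (i , i∈s′ , refl) → (i , y∈p∖x⇒y∈p i∈s′ , refl) , positive i (y∈p∖x⇒y≢x i∈s′) }
    where
    positive : ∀ i → i ≢ opposite t → outcome (pairs₄ t) (pairs₄ i) ≡ true
    positive i i≢ = [ (λ e → ⊥-elim (i≢ e)) , id ]′ (pairs₄-meet t i)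

M[2,2,4]≡5 : IsM 2 2 4 (fin 5)
M[2,2,4]≡5 = (search₄ , search₄-size , search₄-solves , search₄-uses) ,
  λ A m size-2 solves uses → adversary-lower-bound adversary₄ A size-2 solves uses ⊤ (s≤s z≤n)

⌈n/2⌉≤1+⌊n/2⌋ : ∀ n → ⌈ n /2⌉ ≤ suc ⌊ n /2⌋
⌈n/2⌉≤1+⌊n/2⌋ zero = z≤n
⌈n/2⌉≤1+⌊n/2⌋ (suc zero) = ≤-refl
⌈n/2⌉≤1+⌊n/2⌋ (suc (suc n)) = s≤s (⌈n/2⌉≤1+⌊n/2⌋ n)

n/2≡⌊n/2⌋ : ∀ n → n / 2 ≡ ⌊ n /2⌋
n/2≡⌊n/2⌋ zero = refl
n/2≡⌊n/2⌋ (suc zero) = refl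
n/2≡⌊n/2⌋ (suc (suc n)) =
  trans (m/n≡1+[m∸n]/n {suc (suc n)} {2} (s≤s (s≤s z≤n))) (cong suc (n/2≡⌊n/2⌋ n))

-- Lower bounds on the number of remaining tests for the candidate families below,
-- as functions of the size of the set that parametrises each family.
withinBound : ℕ → ℕ
withinBound 3 = 2
withinBound 4 = 3
withinBound (suc (suc (suc (suc (suc k))))) = ⌊ 5 + k /2⌋ + 2
withinBound _ = 0

starBound : ℕ → ℕ
starBound (suc (suc k)) = ⌈ 2 + k /2⌉
starBound _ = 0

fanBound : ℕ → ℕ
fanBound zero = 0
fanBound (suc w) = ⌊ suc w /2⌋ + 2

withinBound≡⌊n/2⌋+2 : ∀ n → 5 ≤ n → withinBound n ≡ ⌊ n /2⌋ + 2
withinBound≡⌊n/2⌋+2 (suc (suc (suc (suc (suc n))))) _ = refl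
withinBound≡⌊n/2⌋+2 1 (s≤s ())
withinBound≡⌊n/2⌋+2 2 (s≤s (s≤s ()))
withinBound≡⌊n/2⌋+2 3 (s≤s (s≤s (s≤s ())))
withinBound≡⌊n/2⌋+2 4 (s≤s (s≤s (s≤s (s≤s ()))))

1≤withinBound⇒3≤ : ∀ u → 1 ≤ withinBound u → 3 ≤ u
1≤withinBound⇒3≤ (suc (suc (suc u))) _ = s≤s (s≤s (s≤s z≤n))
1≤withinBound⇒3≤ 0 ()
1≤withinBound⇒3≤ 1 ()
1≤withinBound⇒3≤ 2 ()

1≤starBound⇒2≤ : ∀ k → 1 ≤ starBound k → 2 ≤ k
1≤starBound⇒2≤ (suc (suc k)) _ = s≤s (s≤s z≤n)
1≤starBound⇒2≤ 0 ()
1≤starBound⇒2≤ 1 ()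

1≤fanBound⇒1≤ : ∀ k → 1 ≤ fanBound k → 1 ≤ k
1≤fanBound⇒1≤ (suc k) _ = s≤s z≤n
1≤fanBound⇒1≤ 0 ()

withinBound[1+u]≤1+withinBound[u] : ∀ u → 3 ≤ u → withinBound (suc u) ≤ suc (withinBound u)
withinBound[1+u]≤1+withinBound[u] 3 _ = ≤-refl
withinBound[1+u]≤1+withinBound[u] 4 _ = ≤-refl
withinBound[1+u]≤1+withinBound[u] (suc (suc (suc (suc (suc k))))) _ =
  ℕ.+-monoˡ-≤ 2 (⌈n/2⌉≤1+⌊n/2⌋ (5 + k))
withinBound[1+u]≤1+withinBound[u] 1 (s≤s ())
withinBound[1+u]≤1+withinBound[u] 2 (s≤s (s≤s ()))

withinBound≤1+starBound : ∀ u k → u ≤ 3 → u ≤ suc k → withinBound u ≤ suc (starBound k)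
withinBound≤1+starBound 0 k _ _ = z≤n
withinBound≤1+starBound 1 k _ _ = z≤n
withinBound≤1+starBound 2 k _ _ = z≤n
withinBound≤1+starBound 3 (suc (suc k)) _ _ = s≤s (s≤s z≤n)
withinBound≤1+starBound 3 (suc zero) _ (s≤s (s≤s ()))
withinBound≤1+starBound 3 zero _ (s≤s ())
withinBound≤1+starBound (suc (suc (suc (suc u)))) k (s≤s (s≤s (s≤s ()))) _

withinBound[2+w]≤1+fanBound[w] : ∀ w → withinBound (2 + w) ≤ suc (fanBound w)
withinBound[2+w]≤1+fanBound[w] 0 = z≤n
withinBound[2+w]≤1+fanBound[w] 1 = s≤s (s≤s z≤n)
withinBound[2+w]≤1+fanBound[w] 2 = s≤s (s≤s (s≤s z≤n))
withinBound[2+w]≤1+fanBound[w] (suc (suc (suc w))) = ≤-refl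

starBound[1+k]≤1+starBound[k] : ∀ k → starBound (suc k) ≤ suc (starBound k)
starBound[1+k]≤1+starBound[k] 0 = z≤n
starBound[1+k]≤1+starBound[k] 1 = ≤-refl
starBound[1+k]≤1+starBound[k] (suc (suc k)) = s≤s (ℕ.⌊n/2⌋-mono (ℕ.n≤1+n (2 + k)))

starBound[2+k]≤1+starBound[k] : ∀ k → 2 ≤ k → starBound (2 + k) ≤ suc (starBound k)
starBound[2+k]≤1+starBound[k] (suc (suc k)) _ = ≤-refl
starBound[2+k]≤1+starBound[k] 1 (s≤s ())

starBound≤2 : ∀ k → k ≤ 3 → starBound k ≤ 2
starBound≤2 0 _ = z≤n
starBound≤2 1 _ = z≤n
starBound≤2 2 _ = s≤s z≤n
starBound≤2 3 _ = ≤-refl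
starBound≤2 (suc (suc (suc (suc k)))) (s≤s (s≤s (s≤s ())))

fanBound≤1+starBound[1+w] : ∀ w → fanBound w ≤ suc (starBound (suc w))
fanBound≤1+starBound[1+w] 0 = z≤n
fanBound≤1+starBound[1+w] (suc w) = ℕ.≤-reflexive (ℕ.+-comm ⌊ suc w /2⌋ 2)

fanBound[1+k]≤1+fanBound[k] : ∀ k → 1 ≤ k → fanBound (suc k) ≤ suc (fanBound k)
fanBound[1+k]≤1+fanBound[k] (suc k) _ = ℕ.+-monoˡ-≤ 2 (⌈n/2⌉≤1+⌊n/2⌋ (suc k))
fanBound[1+k]≤1+fanBound[k] 0 ()

fanBound[2+k]≤1+fanBound[k] : ∀ k → 1 ≤ k → fanBound (2 + k) ≤ suc (fanBound k)
fanBound[2+k]≤1+fanBound[k] (suc k) _ = ≤-refl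
fanBound[2+k]≤1+fanBound[k] 0 ()

fanBound≤2 : ∀ w → w ≤ 1 → fanBound w ≤ 2
fanBound≤2 0 _ = z≤n
fanBound≤2 1 _ = ≤-refl
fanBound≤2 (suc (suc w)) (s≤s ())

fanBound≤3 : ∀ w → w ≤ 2 → fanBound w ≤ 3
fanBound≤3 0 _ = z≤n
fanBound≤3 1 _ = s≤s (s≤s z≤n)
fanBound≤3 2 _ = ≤-refl
fanBound≤3 (suc (suc (suc w))) (s≤s (s≤s ()))

-- The shapes of the family of pairs still consistent with the answers, for n ≥ 5;
-- `Candidate s x y` says that {x , y} belongs to the family s.
data Candidates (n : ℕ) : Set where
  within : (U : Subset n) → Candidates n
  star   : (a : Fin n) (V : Subset n) → a ∉ V → Candidates n
  fan    : (a b : Fin n) (W : Subset n) → a ≢ b → a ∉ W → b ∉ W → Candidates n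
  grid   : (a b c d : Fin n) → a ≢ b → c ≢ d → a ≢ c → a ≢ d → b ≢ c → b ≢ d → Candidates n

module _ {n : ℕ} where

  Candidate : Candidates n → Fin n → Fin n → Set
  Candidate (within U) x y = x ∈ U × y ∈ U
  Candidate (star a V _) x y = x ≡ a × y ∈ V
  Candidate (fan a b W _ _ _) x y = (x ≡ a ⊎ x ≡ b) × (y ≡ a ⊎ (y ≡ b ⊎ y ∈ W))
  Candidate (grid a b c d _ _ _ _ _ _) x y = (x ≡ a ⊎ x ≡ b) × (y ≡ c ⊎ y ≡ d)

  Admits : Candidates n → Subset n → Set
  Admits s D = ∃₂ λ x y → x ≢ y × D ≡ pair x y × Candidate s x y

  bound : Candidates n → ℕ
  bound (within U) = withinBound ∣ U ∣
  bound (star _ V _) = starBound ∣ V ∣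
  bound (fan _ _ W _ _ _) = fanBound ∣ W ∣
  bound (grid _ _ _ _ _ _ _ _ _ _) = 2

  admits-size : ∀ {s D} → Admits s D → ∣ D ∣ ≡ 2
  admits-size (x , y , x≢y , refl , _) = ∣pair∣≡2 x≢y

  ∈∉⇒≢ : ∀ {x t : Fin n} {U : Subset n} → x ∈ U → t ∉ U → x ≢ t
  ∈∉⇒≢ x∈U t∉U refl = t∉U x∈U

  two-admitted : ∀ s → 1 ≤ bound s → ∃₂ λ D D′ → Admits s D × Admits s D′ × D ≢ D′
  two-admitted (within U) 1≤bound
    with ∣p∣>0⇒Nonempty U (≤-trans (s≤s z≤n) (1≤withinBound⇒3≤ ∣ U ∣ 1≤bound))
  ... | x , x∈U with two-members (U ∖ x) (k<∣p∣⇒k≤∣p∖x∣ x∈U (1≤withinBound⇒3≤ ∣ U ∣ 1≤bound))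
  ... | y , z , y≢z , y∈ , z∈ =
    pair x y , pair x z ,
    (x , y , ≢-sym (y∈p∖x⇒y≢x y∈) , refl , x∈U , y∈p∖x⇒y∈p y∈) ,
    (x , z , ≢-sym (y∈p∖x⇒y≢x z∈) , refl , x∈U , y∈p∖x⇒y∈p z∈) ,
    pair-≢ (y∈p∖x⇒y≢x z∈) (≢-sym y≢z)
  two-admitted (star a V a∉V) 1≤bound with two-members V (1≤starBound⇒2≤ ∣ V ∣ 1≤bound)
  ... | y , z , y≢z , y∈V , z∈V =
    pair a y , pair a z ,
    (a , y , ≢-sym (∈∉⇒≢ y∈V a∉V) , refl , refl , y∈V) ,
    (a , z , ≢-sym (∈∉⇒≢ z∈V a∉V) , refl , refl , z∈V) ,
    pair-≢ (∈∉⇒≢ z∈V a∉V) (≢-sym y≢z)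
  two-admitted (fan a b W a≢b a∉W b∉W) 1≤bound with ∣p∣>0⇒Nonempty W (1≤fanBound⇒1≤ ∣ W ∣ 1≤bound)
  ... | v , v∈W =
    pair a b , pair a v ,
    (a , b , a≢b , refl , inj₁ refl , inj₂ (inj₁ refl)) ,
    (a , v , ≢-sym (∈∉⇒≢ v∈W a∉W) , refl , inj₁ refl , inj₂ (inj₂ v∈W)) ,
    pair-≢ (∈∉⇒≢ v∈W a∉W) (∈∉⇒≢ v∈W b∉W)
  two-admitted (grid a b c d a≢b c≢d a≢c a≢d b≢c b≢d) _ =
    pair a c , pair a d ,
    (a , c , a≢c , refl , inj₁ refl , inj₁ refl) ,
    (a , d , a≢d , refl , inj₁ refl , inj₂ refl) ,
    pair-≢ (≢-sym a≢d) (≢-sym c≢d)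

  record Response (s : Candidates n) (T : Subset n) : Set where
    field
      bit    : Bool
      next   : Candidates n
      bound≤ : bound s ≤ suc (bound next)
      back   : ∀ {D} → Admits next D → Admits s D × outcome T D ≡ bit

  Refines : Candidates n → Candidates n → Subset n → Bool → Set
  Refines s s′ T b = ∀ {x y} → Candidate s′ x y →
    (Candidate s x y ⊎ Candidate s y x) × outcome T (pair x y) ≡ b

  respond : ∀ {s T} b s′ → bound s ≤ suc (bound s′) → Refines s s′ T b → Response s T
  respond b s′ bound≤ refines = record { bit = b ; next = s′ ; bound≤ = bound≤ ; back = back }
    where
    back : ∀ {D} → Admits s′ D → _
    back (x , y , x≢y , refl , c) with refines c
    ... | inj₁ c′ , o = (x , y , x≢y , refl , c′) , o
    ... | inj₂ c′ , o = (y , x , ≢-sym x≢y , pair-comm x y , c′) , o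

  keep : ∀ {s T} b → (∀ {x y} → Candidate s x y → outcome T (pair x y) ≡ b) → Response s T
  keep {s} b answers = respond b s (m≤n⇒m≤1+n ≤-refl) λ c → inj₁ c , answers c

  module Answers (T : Subset n) (t₁ t₂ : Fin n) (t₁≢t₂ : t₁ ≢ t₂) (t₁∈T : t₁ ∈ T) (t₂∈T : t₂ ∈ T)
                 (T⊆t₁t₂ : ∀ {z} → z ∈ T → z ≡ t₁ ⊎ z ≡ t₂) where

    ∉T : ∀ {x} → x ≢ t₁ → x ≢ t₂ → x ∉ T
    ∉T x≢t₁ x≢t₂ x∈T = [ x≢t₁ , x≢t₂ ] (T⊆t₁t₂ x∈T)

    ∉T-outside : ∀ {U : Subset n} {x} → x ∈ U → t₁ ∉ U → t₂ ∉ U → x ∉ T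
    ∉T-outside x∈U t₁∉U t₂∉U = ∉T (∈∉⇒≢ x∈U t₁∉U) (∈∉⇒≢ x∈U t₂∉U)

    ∉T-∖t₁ : ∀ {U : Subset n} {x} → x ∈ U ∖ t₁ → t₂ ∉ U → x ∉ T
    ∉T-∖t₁ {U} x∈ t₂∉U = ∉T (y∈p∖x⇒y≢x {p = U} x∈) (∈∉⇒≢ (y∈p∖x⇒y∈p {p = U} x∈) t₂∉U)

    ∉T-∖t₁t₂ : ∀ {U : Subset n} {x} → x ∈ U ∖ t₁ ∖ t₂ → x ∉ T
    ∉T-∖t₁t₂ {U} x∈ = ∉T (y∈p∖x⇒y≢x {p = U} (y∈p∖x⇒y∈p {p = U ∖ t₁} x∈)) (y∈p∖x⇒y≢x {p = U ∖ t₁} x∈)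

    ∈∖t₁t₂⇒∈ : ∀ {U : Subset n} {x} → x ∈ U ∖ t₁ ∖ t₂ → x ∈ U
    ∈∖t₁t₂⇒∈ {U} x∈ = y∈p∖x⇒y∈p {p = U} (y∈p∖x⇒y∈p {p = U ∖ t₁} x∈)

    pair∈T : ∀ {x y} → x ∈ T → outcome T (pair x y) ≡ true
    pair∈T x∈T = outcome-pair≡true (inj₁ x∈T)

    either∈T : ∀ {a b x} → a ∈ T → b ∈ T → x ≡ a ⊎ x ≡ b → x ∈ T
    either∈T a∈T b∈T = [ (λ { refl → a∈T }) , (λ { refl → b∈T }) ]

    neither∈T : ∀ {a b x} → a ∉ T → b ∉ T → x ≡ a ⊎ x ≡ b → x ∉ T
    neither∈T a∉T b∉T = [ (λ { refl → a∉T }) , (λ { refl → b∉T }) ]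

    fan-∉T : ∀ {a b W y} → a ∉ T → b ∉ T → (∀ {w} → w ∈ W → w ∉ T) → y ≡ a ⊎ (y ≡ b ⊎ y ∈ W) → y ∉ T
    fan-∉T a∉T b∉T W∉T = [ (λ { refl → a∉T }) , [ (λ { refl → b∉T }) , W∉T ]′ ]′

    ∈pair-T⇒∈T : ∀ {y} → y ∈ pair t₁ t₂ → y ∈ T
    ∈pair-T⇒∈T = either∈T t₁∈T t₂∈T ∘ ∈pair⁻

    within-none : ∀ U → t₁ ∉ U → t₂ ∉ U → Response (within U) T
    within-none U t₁∉U t₂∉U =
      keep false λ (x∈U , y∈U) → outcome-pair≡false (∉T-outside x∈U t₁∉U t₂∉U) (∉T-outside y∈U t₁∉U t₂∉U)

    within-one : ∀ U → t₁ ∈ U → t₂ ∉ U → Response (within U) T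
    within-one U t₁∈U t₂∉U with 4 ≤? ∣ U ∣
    ... | yes 4≤∣U∣ = respond false (within (U ∖ t₁)) bound≤ λ (x∈ , y∈) →
      inj₁ (y∈p∖x⇒y∈p x∈ , y∈p∖x⇒y∈p y∈) , outcome-pair≡false (∉T-∖t₁ x∈ t₂∉U) (∉T-∖t₁ y∈ t₂∉U)
      where
      bound≤ : withinBound ∣ U ∣ ≤ suc (withinBound ∣ U ∖ t₁ ∣)
      bound≤ rewrite sym (x∈p⇒1+∣p∖x∣≡∣p∣ t₁∈U) = withinBound[1+u]≤1+withinBound[u] _ (ℕ.≤-pred 4≤∣U∣)
    ... | no 4≰∣U∣ = respond true (star t₁ (U ∖ t₁) (x∉p∖x U t₁))
      (withinBound≤1+starBound _ _ (ℕ.≤-pred (ℕ.≰⇒> 4≰∣U∣)) (∣p∣≤1+∣p∖x∣ U t₁))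
      λ { (refl , y∈) → inj₁ (t₁∈U , y∈p∖x⇒y∈p y∈) , pair∈T t₁∈T }

    within-both : ∀ U → t₁ ∈ U → t₂ ∈ U → Response (within U) T
    within-both U t₁∈U t₂∈U = respond true (fan t₁ t₂ W t₁≢t₂ t₁∉W t₂∉W) bound≤ λ (x∈ , y∈) →
      inj₁ (∈U (Sum.map₂ inj₁ x∈) , ∈U y∈) , pair∈T (either∈T t₁∈T t₂∈T x∈)
      where
      W = U ∖ t₁ ∖ t₂
      t₂∉W : t₂ ∉ W
      t₂∉W = x∉p∖x (U ∖ t₁) t₂
      t₁∉W : t₁ ∉ W
      t₁∉W t₁∈W = x∉p∖x U t₁ (y∈p∖x⇒y∈p {p = U ∖ t₁} t₁∈W)
      bound≤ : withinBound ∣ U ∣ ≤ suc (fanBound ∣ W ∣)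
      bound≤ rewrite sym (2+∣p∖x∖y∣≡∣p∣ t₁∈U t₂∈U t₁≢t₂) = withinBound[2+w]≤1+fanBound[w] ∣ W ∣
      ∈U : ∀ {y} → y ≡ t₁ ⊎ (y ≡ t₂ ⊎ y ∈ W) → y ∈ U
      ∈U (inj₁ refl) = t₁∈U
      ∈U (inj₂ (inj₁ refl)) = t₂∈U
      ∈U (inj₂ (inj₂ y∈W)) = ∈∖t₁t₂⇒∈ y∈W

    star-centre : ∀ a V a∉V → a ∈ T → Response (star a V a∉V) T
    star-centre a V a∉V a∈T = keep true λ { (refl , _) → pair∈T a∈T }

    star-none : ∀ a V a∉V → a ∉ T → t₁ ∉ V → t₂ ∉ V → Response (star a V a∉V) T
    star-none a V a∉V a∉T t₁∉V t₂∉V =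
      keep false λ { (refl , y∈V) → outcome-pair≡false a∉T (∉T-outside y∈V t₁∉V t₂∉V) }

    star-one : ∀ a V a∉V → a ∉ T → t₁ ∈ V → t₂ ∉ V → Response (star a V a∉V) T
    star-one a V a∉V a∉T t₁∈V t₂∉V = respond false (star a (V ∖ t₁) (a∉V ∘ y∈p∖x⇒y∈p)) bound≤
      λ { (refl , y∈) → inj₁ (refl , y∈p∖x⇒y∈p y∈) , outcome-pair≡false a∉T (∉T-∖t₁ y∈ t₂∉V) }
      where
      bound≤ : starBound ∣ V ∣ ≤ suc (starBound ∣ V ∖ t₁ ∣)
      bound≤ rewrite sym (x∈p⇒1+∣p∖x∣≡∣p∣ t₁∈V) = starBound[1+k]≤1+starBound[k] ∣ V ∖ t₁ ∣

    star-both : ∀ a V a∉V → a ∉ T → t₁ ∈ V → t₂ ∈ V → Response (star a V a∉V) T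
    star-both a V a∉V a∉T t₁∈V t₂∈V with 4 ≤? ∣ V ∣
    ... | yes 4≤∣V∣ = respond false (star a (V ∖ t₁ ∖ t₂) (a∉V ∘ ∈∖t₁t₂⇒∈)) bound≤
      λ { (refl , y∈) → inj₁ (refl , ∈∖t₁t₂⇒∈ y∈) , outcome-pair≡false a∉T (∉T-∖t₁t₂ y∈) }
      where
      ∣V∣≡ = 2+∣p∖x∖y∣≡∣p∣ t₁∈V t₂∈V t₁≢t₂
      bound≤ : starBound ∣ V ∣ ≤ suc (starBound ∣ V ∖ t₁ ∖ t₂ ∣)
      bound≤ rewrite sym ∣V∣≡ =
        starBound[2+k]≤1+starBound[k] _ (ℕ.≤-pred (ℕ.≤-pred 4≤∣V∣))
    ... | no 4≰∣V∣ = respond true (star a (pair t₁ t₂) (a∉T ∘ ∈pair-T⇒∈T)) bound≤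
      λ { (refl , y∈) → inj₁ (refl , [ (λ { refl → t₁∈V }) , (λ { refl → t₂∈V }) ] (∈pair⁻ y∈)) ,
                         outcome-pair≡true (inj₂ (∈pair-T⇒∈T y∈)) }
      where
      bound≤ : starBound ∣ V ∣ ≤ suc (starBound ∣ pair t₁ t₂ ∣)
      bound≤ rewrite ∣pair∣≡2 t₁≢t₂ = starBound≤2 _ (ℕ.≤-pred (ℕ.≰⇒> 4≰∣V∣))

    fan-both : ∀ a b W a≢b a∉W b∉W → a ∈ T → b ∈ T → Response (fan a b W a≢b a∉W b∉W) T
    fan-both a b W a≢b a∉W b∉W a∈T b∈T = keep true λ (x∈ , _) → pair∈T (either∈T a∈T b∈T x∈)

    fan-left : ∀ a b W a≢b a∉W b∉W → a ∈ T → b ∉ T → Response (fan a b W a≢b a∉W b∉W) T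
    fan-left a b W a≢b a∉W b∉W a∈T b∉T = respond true (star a (W ∪ ⁅ b ⁆) a∉W∪b) bound≤
      λ { (refl , y∈) → inj₁ (inj₁ refl , inj₂ (from-W∪b y∈)) , pair∈T a∈T }
      where
      from-W∪b : ∀ {y} → y ∈ W ∪ ⁅ b ⁆ → y ≡ b ⊎ y ∈ W
      from-W∪b y∈ = [ inj₂ , inj₁ ∘ x∈⁅y⁆⇒x≡y b ]′ (x∈p∪q⁻ W ⁅ b ⁆ y∈)
      a∉W∪b : a ∉ W ∪ ⁅ b ⁆
      a∉W∪b a∈ = [ a∉W , a≢b ∘ x∈⁅y⁆⇒x≡y b ]′ (x∈p∪q⁻ W ⁅ b ⁆ a∈)
      bound≤ : fanBound ∣ W ∣ ≤ suc (starBound ∣ W ∪ ⁅ b ⁆ ∣)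
      bound≤ rewrite ∣p∪⁅x⁆∣≡1+∣p∣ W b∉W = fanBound≤1+starBound[1+w] ∣ W ∣

    fan-right : ∀ a b W a≢b a∉W b∉W → a ∉ T → b ∈ T → Response (fan a b W a≢b a∉W b∉W) T
    fan-right a b W a≢b a∉W b∉W a∉T b∈T = respond true (star b (W ∪ ⁅ a ⁆) b∉W∪a) bound≤
      λ { (refl , y∈) → inj₁ (inj₂ refl , from-W∪a y∈) , pair∈T b∈T }
      where
      from-W∪a : ∀ {y} → y ∈ W ∪ ⁅ a ⁆ → y ≡ a ⊎ (y ≡ b ⊎ y ∈ W)
      from-W∪a y∈ = [ inj₂ ∘ inj₂ , inj₁ ∘ x∈⁅y⁆⇒x≡y a ]′ (x∈p∪q⁻ W ⁅ a ⁆ y∈)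
      b∉W∪a : b ∉ W ∪ ⁅ a ⁆
      b∉W∪a b∈ = [ b∉W , ≢-sym a≢b ∘ x∈⁅y⁆⇒x≡y a ]′ (x∈p∪q⁻ W ⁅ a ⁆ b∈)
      bound≤ : fanBound ∣ W ∣ ≤ suc (starBound ∣ W ∪ ⁅ a ⁆ ∣)
      bound≤ rewrite ∣p∪⁅x⁆∣≡1+∣p∣ W a∉W = fanBound≤1+starBound[1+w] ∣ W ∣

    fan-none : ∀ a b W a≢b a∉W b∉W → a ∉ T → b ∉ T → t₁ ∉ W → t₂ ∉ W → Response (fan a b W a≢b a∉W b∉W) T
    fan-none a b W a≢b a∉W b∉W a∉T b∉T t₁∉W t₂∉W = keep false λ (x∈ , y∈) →
      outcome-pair≡false (neither∈T a∉T b∉T x∈) (fan-∉T a∉T b∉T (λ w∈W → ∉T-outside w∈W t₁∉W t₂∉W) y∈)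

    fan-one : ∀ a b W a≢b a∉W b∉W → a ∉ T → b ∉ T → t₁ ∈ W → t₂ ∉ W → Response (fan a b W a≢b a∉W b∉W) T
    fan-one a b W a≢b a∉W b∉W a∉T b∉T t₁∈W t₂∉W with 2 ≤? ∣ W ∣
    ... | yes 2≤∣W∣ = respond false (fan a b (W ∖ t₁) a≢b (a∉W ∘ y∈p∖x⇒y∈p) (b∉W ∘ y∈p∖x⇒y∈p)) bound≤
      λ (x∈ , y∈) → inj₁ (x∈ , Sum.map₂ (Sum.map₂ y∈p∖x⇒y∈p) y∈) ,
                    outcome-pair≡false (neither∈T a∉T b∉T x∈) (fan-∉T a∉T b∉T (λ w∈ → ∉T-∖t₁ w∈ t₂∉W) y∈)
      where
      ∣W∣≡ = x∈p⇒1+∣p∖x∣≡∣p∣ t₁∈W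
      bound≤ : fanBound ∣ W ∣ ≤ suc (fanBound ∣ W ∖ t₁ ∣)
      bound≤ rewrite sym ∣W∣≡ = fanBound[1+k]≤1+fanBound[k] _ (ℕ.≤-pred 2≤∣W∣)
    ... | no 2≰∣W∣ = respond true (star t₁ (pair a b) (λ t₁∈ → neither∈T a∉T b∉T (∈pair⁻ t₁∈) t₁∈T)) bound≤
      λ { (refl , y∈) → inj₂ (∈pair⁻ y∈ , inj₂ (inj₂ t₁∈W)) , pair∈T t₁∈T }
      where
      bound≤ : fanBound ∣ W ∣ ≤ suc (starBound ∣ pair a b ∣)
      bound≤ rewrite ∣pair∣≡2 a≢b = fanBound≤2 _ (ℕ.≤-pred (ℕ.≰⇒> 2≰∣W∣))

    fan-two : ∀ a b W a≢b a∉W b∉W → a ∉ T → b ∉ T → t₁ ∈ W → t₂ ∈ W → Response (fan a b W a≢b a∉W b∉W) T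
    fan-two a b W a≢b a∉W b∉W a∉T b∉T t₁∈W t₂∈W with 3 ≤? ∣ W ∣
    ... | yes 3≤∣W∣ = respond false (fan a b (W ∖ t₁ ∖ t₂) a≢b (a∉W ∘ ∈∖t₁t₂⇒∈) (b∉W ∘ ∈∖t₁t₂⇒∈)) bound≤
      λ (x∈ , y∈) → inj₁ (x∈ , Sum.map₂ (Sum.map₂ ∈∖t₁t₂⇒∈) y∈) ,
                    outcome-pair≡false (neither∈T a∉T b∉T x∈) (fan-∉T a∉T b∉T ∉T-∖t₁t₂ y∈)
      where
      ∣W∣≡ = 2+∣p∖x∖y∣≡∣p∣ t₁∈W t₂∈W t₁≢t₂
      bound≤ : fanBound ∣ W ∣ ≤ suc (fanBound ∣ W ∖ t₁ ∖ t₂ ∣)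
      bound≤ rewrite sym ∣W∣≡ =
        fanBound[2+k]≤1+fanBound[k] _ (ℕ.≤-pred (ℕ.≤-pred 3≤∣W∣))
    ... | no 3≰∣W∣ =
      respond true (grid a b t₁ t₂ a≢b t₁≢t₂ (≢t a∉T t₁∈T) (≢t a∉T t₂∈T) (≢t b∉T t₁∈T) (≢t b∉T t₂∈T))
      (fanBound≤3 _ (ℕ.≤-pred (ℕ.≰⇒> 3≰∣W∣)))
      λ { (x∈ , inj₁ refl) → inj₁ (x∈ , inj₂ (inj₂ t₁∈W)) , outcome-pair≡true (inj₂ t₁∈T)
        ; (x∈ , inj₂ refl) → inj₁ (x∈ , inj₂ (inj₂ t₂∈W)) , outcome-pair≡true (inj₂ t₂∈T) }
      where
      ≢t : ∀ {x t} → x ∉ T → t ∈ T → x ≢ t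
      ≢t x∉T t∈T refl = x∉T t∈T

    grid-left : ∀ a b c d a≢b c≢d a≢c a≢d b≢c b≢d x → x ∈ T → x ≡ a ⊎ x ≡ b → x ≢ c → x ≢ d →
                Response (grid a b c d a≢b c≢d a≢c a≢d b≢c b≢d) T
    grid-left a b c d a≢b c≢d a≢c a≢d b≢c b≢d x x∈T x∈ab x≢c x≢d =
      respond true (star x (pair c d) (∉pair x≢c x≢d))
        (subst (λ k → 2 ≤ suc (starBound k)) (sym (∣pair∣≡2 c≢d)) ≤-refl)
      λ { (refl , y∈) → inj₁ (x∈ab , ∈pair⁻ y∈) , pair∈T x∈T }

    grid-right : ∀ a b c d a≢b c≢d a≢c a≢d b≢c b≢d y → y ∈ T → y ≡ c ⊎ y ≡ d → y ≢ a → y ≢ b →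
                 Response (grid a b c d a≢b c≢d a≢c a≢d b≢c b≢d) T
    grid-right a b c d a≢b c≢d a≢c a≢d b≢c b≢d y y∈T y∈cd y≢a y≢b =
      respond true (star y (pair a b) (∉pair y≢a y≢b))
        (subst (λ k → 2 ≤ suc (starBound k)) (sym (∣pair∣≡2 a≢b)) ≤-refl)
      λ { (refl , x∈) → inj₂ (∈pair⁻ x∈ , y∈cd) , pair∈T y∈T }

    grid-none : ∀ a b c d a≢b c≢d a≢c a≢d b≢c b≢d → a ∉ T → b ∉ T → c ∉ T → d ∉ T →
                Response (grid a b c d a≢b c≢d a≢c a≢d b≢c b≢d) T
    grid-none a b c d a≢b c≢d a≢c a≢d b≢c b≢d a∉T b∉T c∉T d∉T =
      keep false λ (x∈ , y∈) → outcome-pair≡false (neither∈T a∉T b∉T x∈) (neither∈T c∉T d∉T y∈)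

  answer : ∀ s (t₁ t₂ : Fin n) → t₁ ≢ t₂ → Response s (pair t₁ t₂)
  answer s t₁ t₂ t₁≢t₂ = go s
    where
    T = pair t₁ t₂
    module A = Answers T t₁ t₂ t₁≢t₂ (x∈pair t₁ t₂) (y∈pair t₁ t₂) ∈pair⁻
    module B = Answers T t₂ t₁ (≢-sym t₁≢t₂) (y∈pair t₁ t₂) (x∈pair t₁ t₂) (Sum.swap ∘ ∈pair⁻)
    go : ∀ s → Response s T
    go (within U) with t₁ ∈? U | t₂ ∈? U
    ... | yes t₁∈U | yes t₂∈U = A.within-both U t₁∈U t₂∈U
    ... | yes t₁∈U | no t₂∉U = A.within-one U t₁∈U t₂∉U
    ... | no t₁∉U | yes t₂∈U = B.within-one U t₂∈U t₁∉U
    ... | no t₁∉U | no t₂∉U = A.within-none U t₁∉U t₂∉U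
    go (star a V a∉V) with a ∈? T
    ... | yes a∈T = A.star-centre a V a∉V a∈T
    ... | no a∉T with t₁ ∈? V | t₂ ∈? V
    ...   | yes t₁∈V | yes t₂∈V = A.star-both a V a∉V a∉T t₁∈V t₂∈V
    ...   | yes t₁∈V | no t₂∉V = A.star-one a V a∉V a∉T t₁∈V t₂∉V
    ...   | no t₁∉V | yes t₂∈V = B.star-one a V a∉V a∉T t₂∈V t₁∉V
    ...   | no t₁∉V | no t₂∉V = A.star-none a V a∉V a∉T t₁∉V t₂∉V
    go (fan a b W a≢b a∉W b∉W) with a ∈? T | b ∈? T
    ... | yes a∈T | yes b∈T = A.fan-both a b W a≢b a∉W b∉W a∈T b∈T
    ... | yes a∈T | no b∉T = A.fan-left a b W a≢b a∉W b∉W a∈T b∉T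
    ... | no a∉T | yes b∈T = A.fan-right a b W a≢b a∉W b∉W a∉T b∈T
    ... | no a∉T | no b∉T with t₁ ∈? W | t₂ ∈? W
    ...   | yes t₁∈W | yes t₂∈W = A.fan-two a b W a≢b a∉W b∉W a∉T b∉T t₁∈W t₂∈W
    ...   | yes t₁∈W | no t₂∉W = A.fan-one a b W a≢b a∉W b∉W a∉T b∉T t₁∈W t₂∉W
    ...   | no t₁∉W | yes t₂∈W = B.fan-one a b W a≢b a∉W b∉W a∉T b∉T t₂∈W t₁∉W
    ...   | no t₁∉W | no t₂∉W = A.fan-none a b W a≢b a∉W b∉W a∉T b∉T t₁∉W t₂∉W
    go (grid a b c d a≢b c≢d a≢c a≢d b≢c b≢d) with a ∈? T | b ∈? T | c ∈? T | d ∈? T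
    ... | yes a∈T | _ | _ | _ = A.grid-left a b c d a≢b c≢d a≢c a≢d b≢c b≢d a a∈T (inj₁ refl) a≢c a≢d
    ... | no _ | yes b∈T | _ | _ = A.grid-left a b c d a≢b c≢d a≢c a≢d b≢c b≢d b b∈T (inj₂ refl) b≢c b≢d
    ... | no _ | no _ | yes c∈T | _ =
      A.grid-right a b c d a≢b c≢d a≢c a≢d b≢c b≢d c c∈T (inj₁ refl) (≢-sym a≢c) (≢-sym b≢c)
    ... | no _ | no _ | no _ | yes d∈T =
      A.grid-right a b c d a≢b c≢d a≢c a≢d b≢c b≢d d d∈T (inj₂ refl) (≢-sym a≢d) (≢-sym b≢d)
    ... | no a∉T | no b∉T | no c∉T | no d∉T = A.grid-none a b c d a≢b c≢d a≢c a≢d b≢c b≢d a∉T b∉T c∉T d∉T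

adversary : ∀ n → Adversary n 2 2
adversary n = record
  { State        = Candidates n
  ; _admits_     = Admits
  ; potential    = bound
  ; admits-size  = admits-size
  ; two-admitted = two-admitted
  ; answer       = λ s T ∣T∣≡2 →
      let t₁ , t₂ , t₁≢t₂ , T≡ = ∣p∣≡2⇒pair T ∣T∣≡2
          open Response (subst (Response s) (sym T≡) (answer s t₁ t₂ t₁≢t₂))
      in bit , next , bound≤ , back
  }

module _ {n : ℕ} where

  record Identifies (A : Algorithm n) (D : Subset n) (m : ℕ) : Set where
    field
      correct : proj₁ (run A D) ≡ D
      cost≤   : proj₂ (run A D) ≤ m

  identifies-output : ∀ {S D} m → S ≡ D → Identifies (output S) D m
  identifies-output m S≡D = record { correct = S≡D ; cost≤ = z≤n }

  identifies-test : ∀ {T p q D m} b → outcome T D ≡ b → Identifies (if b then p else q) D m →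
                    Identifies (test T p q) D (suc m)
  identifies-test {T} {p} {q} {D} b o≡b ident = record
    { correct = trans (cong proj₁ (run-test p q o≡b)) (Identifies.correct ident)
    ; cost≤   = subst (_≤ _) (sym (cong proj₂ (run-test p q o≡b))) (s≤s (Identifies.cost≤ ident))
    }

  identifies-mono : ∀ {A D m m′} → m ≤ m′ → Identifies A D m → Identifies A D m′
  identifies-mono m≤m′ ident = record
    { correct = Identifies.correct ident ; cost≤ = ≤-trans (Identifies.cost≤ ident) m≤m′ }

  identifies-swap : ∀ {A x y m} → Identifies A (pair y x) m → Identifies A (pair x y) m
  identifies-swap {A} {x} {y} {m} = subst (λ D → Identifies A D m) (pair-comm y x)

  via-positive : ∀ {p q x y m} {A B : Algorithm n} → x ∈ pair p q ⊎ y ∈ pair p q →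
        Identifies A (pair x y) m → Identifies (test (pair p q) A B) (pair x y) (suc m)
  via-positive meets = identifies-test true (outcome-pair≡true meets)

  via-negative : ∀ {p q x y m} {A B : Algorithm n} → x ∉ pair p q → y ∉ pair p q →
         Identifies B (pair x y) m → Identifies (test (pair p q) A B) (pair x y) (suc m)
  via-negative x∉ y∉ = identifies-test false (outcome-pair≡false x∉ y∉)

  either≢ : ∀ {a b x z : Fin n} → x ≡ a ⊎ x ≡ b → a ≢ z → b ≢ z → x ≢ z
  either≢ (inj₁ refl) a≢z _ = a≢z
  either≢ (inj₂ refl) _ b≢z = b≢z

  All≢⇒≢ : ∀ {v y : Fin n} {W : List (Fin n)} → All (v ≢_) W → y ∈ₗ W → y ≢ v
  All≢⇒≢ v≢W y∈W = ≢-sym (All.lookup v≢W y∈W)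

  pair-test-size : ∀ {p q : Fin n} {A B} → p ≢ q → TestSize 2 A → TestSize 2 B →
                   TestSize 2 (test (pair p q) A B)
  pair-test-size p≢q = test (∣pair∣≡2 p≢q)

  grid-search : (a b c d g : Fin n) → Algorithm n
  grid-search a b c d g =
    test (pair a g) (test (pair c g) (output (pair a c)) (output (pair a d)))
                    (test (pair c g) (output (pair b c)) (output (pair b d)))

  grid-search-size : ∀ {a b c d g : Fin n} → Unique (g ∷ a ∷ b ∷ c ∷ d ∷ []) →
                     TestSize 2 (grid-search a b c d g)
  grid-search-size ((g≢a ∷ _ ∷ g≢c ∷ _) ∷ _) =
    pair-test-size (≢-sym g≢a) (pair-test-size (≢-sym g≢c) (output _) (output _))
                             (pair-test-size (≢-sym g≢c) (output _) (output _))

  grid-search-identifies : ∀ {a b c d g : Fin n} → Unique (g ∷ a ∷ b ∷ c ∷ d ∷ []) →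
    ∀ {x y} → x ≡ a ⊎ x ≡ b → y ≡ c ⊎ y ≡ d → Identifies (grid-search a b c d g) (pair x y) 2
  grid-search-identifies {a} {b} {c} {d} {g}
    ((g≢a ∷ g≢b ∷ g≢c ∷ g≢d ∷ []) ∷ (a≢b ∷ a≢c ∷ a≢d ∷ []) ∷ (b≢c ∷ b≢d ∷ []) ∷ (c≢d ∷ []) ∷ _) = go
    where
    go : ∀ {x y} → x ≡ a ⊎ x ≡ b → y ≡ c ⊎ y ≡ d → Identifies (grid-search a b c d g) (pair x y) 2
    go (inj₁ refl) (inj₁ refl) =
      via-positive (inj₁ (x∈pair a g)) (via-positive (inj₂ (x∈pair c g)) (identifies-output 0 refl))
    go (inj₁ refl) (inj₂ refl) = via-positive (inj₁ (x∈pair a g))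
      (via-negative (∉pair a≢c (≢-sym g≢a)) (∉pair (≢-sym c≢d) (≢-sym g≢d)) (identifies-output 0 refl))
    go (inj₂ refl) (inj₁ refl) = via-negative (∉pair (≢-sym a≢b) (≢-sym g≢b)) (∉pair (≢-sym a≢c) (≢-sym g≢c))
      (via-positive (inj₂ (x∈pair c g)) (identifies-output 0 refl))
    go (inj₂ refl) (inj₂ refl) = via-negative (∉pair (≢-sym a≢b) (≢-sym g≢b)) (∉pair (≢-sym a≢d) (≢-sym g≢d))
      (via-negative (∉pair b≢c (≢-sym g≢b)) (∉pair (≢-sym c≢d) (≢-sym g≢d)) (identifies-output 0 refl))

  FanPair : Fin n → Fin n → List (Fin n) → Fin n → Fin n → Set
  FanPair a b W x y = (x ≡ a ⊎ x ≡ b) × y ∈ₗ a ∷ b ∷ W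

  IdentifiesFan : Algorithm n → Fin n → Fin n → List (Fin n) → ℕ → Set
  IdentifiesFan A a b W m = ∀ {x y} → x ≢ y → FanPair a b W x y → Identifies A (pair x y) m

  IdentifiesWithin : Algorithm n → List (Fin n) → ℕ → Set
  IdentifiesWithin A L m = ∀ {x y} → x ≢ y → x ∈ₗ L → y ∈ₗ L → Identifies A (pair x y) m

  fan-step : (a b v₁ v₂ g : Fin n) → Algorithm n → Algorithm n
  fan-step a b v₁ v₂ g rest = test (pair v₁ v₂) (grid-search a b v₁ v₂ g) rest

  fan-step-size : ∀ {a b v₁ v₂ g : Fin n} {rest} → Unique (g ∷ a ∷ b ∷ v₁ ∷ v₂ ∷ []) → TestSize 2 rest →
                  TestSize 2 (fan-step a b v₁ v₂ g rest)
  fan-step-size u@(_ ∷ _ ∷ _ ∷ (v₁≢v₂ ∷ []) ∷ _) = pair-test-size v₁≢v₂ (grid-search-size u)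

  fan-step-identifies : ∀ {a b v₁ v₂ g : Fin n} {W rest m} → Unique (g ∷ a ∷ b ∷ v₁ ∷ v₂ ∷ []) →
    All (v₁ ≢_) W → All (v₂ ≢_) W → 2 ≤ m → IdentifiesFan rest a b W m →
    IdentifiesFan (fan-step a b v₁ v₂ g rest) a b (v₁ ∷ v₂ ∷ W) (suc m)
  fan-step-identifies {a} {b} {v₁} {v₂} {g} {W} {rest} {m}
    u@(_ ∷ (_ ∷ a≢v₁ ∷ a≢v₂ ∷ []) ∷ (b≢v₁ ∷ b≢v₂ ∷ []) ∷ _) v₁≢W v₂≢W 2≤m rest-identifies {x} x≢y (x∈ , y∈) =
    go x≢y y∈
    where
    x∉v₁v₂ = ∉pair (either≢ x∈ a≢v₁ b≢v₁) (either≢ x∈ a≢v₂ b≢v₂)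
    go : ∀ {y} → x ≢ y → y ∈ₗ a ∷ b ∷ v₁ ∷ v₂ ∷ W → Identifies (fan-step a b v₁ v₂ g rest) (pair x y) (suc m)
    go _ (there (there (here refl))) =
      via-positive (inj₂ (x∈pair v₁ v₂)) (identifies-mono 2≤m (grid-search-identifies u x∈ (inj₁ refl)))
    go _ (there (there (there (here refl)))) =
      via-positive (inj₂ (y∈pair v₁ v₂)) (identifies-mono 2≤m (grid-search-identifies u x∈ (inj₂ refl)))
    go x≢y (here refl) = via-negative x∉v₁v₂ (∉pair a≢v₁ a≢v₂) (rest-identifies x≢y (x∈ , here refl))
    go x≢y (there (here refl)) =
      via-negative x∉v₁v₂ (∉pair b≢v₁ b≢v₂) (rest-identifies x≢y (x∈ , there (here refl)))
    go x≢y (there (there (there (there y∈W)))) =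
      via-negative x∉v₁v₂ (∉pair (All≢⇒≢ v₁≢W y∈W) (All≢⇒≢ v₂≢W y∈W))
      (rest-identifies x≢y (x∈ , there (there y∈W)))

  fan-search : (a b : Fin n) → List (Fin n) → Fin n → Algorithm n
  fan-search a b [] g = output (pair a b)
  fan-search a b (v ∷ []) g =
    test (pair v g) (test (pair a g) (output (pair a v)) (output (pair b v))) (output (pair a b))
  fan-search a b (v₁ ∷ v₂ ∷ W) g = fan-step a b v₁ v₂ g (fan-search a b W g)

  unique-fan-step : ∀ {g a b v₁ v₂ : Fin n} {W} → Unique (g ∷ a ∷ b ∷ v₁ ∷ v₂ ∷ W) →
    Unique (g ∷ a ∷ b ∷ v₁ ∷ v₂ ∷ []) × All (v₁ ≢_) W × All (v₂ ≢_) W × Unique (g ∷ a ∷ b ∷ W)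
  unique-fan-step ((g≢a ∷ g≢b ∷ g≢v₁ ∷ g≢v₂ ∷ g≢W) ∷ (a≢b ∷ a≢v₁ ∷ a≢v₂ ∷ a≢W) ∷ (b≢v₁ ∷ b≢v₂ ∷ b≢W) ∷
                   (v₁≢v₂ ∷ v₁≢W) ∷ v₂≢W ∷ W!) =
    ((g≢a ∷ g≢b ∷ g≢v₁ ∷ g≢v₂ ∷ []) ∷ (a≢b ∷ a≢v₁ ∷ a≢v₂ ∷ []) ∷ (b≢v₁ ∷ b≢v₂ ∷ []) ∷ (v₁≢v₂ ∷ []) ∷ [] ∷ []) ,
    v₁≢W , v₂≢W , (g≢a ∷ g≢b ∷ g≢W) ∷ (a≢b ∷ a≢W) ∷ b≢W ∷ W!

  fan-search-size : ∀ {g a b : Fin n} W → Unique (g ∷ a ∷ b ∷ W) → TestSize 2 (fan-search a b W g)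
  fan-search-size [] _ = output _
  fan-search-size (v ∷ []) ((g≢a ∷ _ ∷ g≢v ∷ []) ∷ _) =
    pair-test-size (≢-sym g≢v) (pair-test-size (≢-sym g≢a) (output _) (output _)) (output _)
  fan-search-size (v₁ ∷ v₂ ∷ W) u =
    let u-grid , _ , _ , u-rest = unique-fan-step u in fan-step-size u-grid (fan-search-size W u-rest)

  fan-search-identifies : ∀ {g a b : Fin n} W → Unique (g ∷ a ∷ b ∷ W) →
                          IdentifiesFan (fan-search a b W g) a b W (⌊ length W /2⌋ + 2)
  fan-search-identifies [] _ x≢y (x∈ , here refl) = identifies-output _ (pair-≡ x≢y x∈ (inj₁ refl))
  fan-search-identifies [] _ x≢y (x∈ , there (here refl)) = identifies-output _ (pair-≡ x≢y x∈ (inj₂ refl))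
  fan-search-identifies {g} {a} {b} (v ∷ []) ((g≢a ∷ g≢b ∷ g≢v ∷ []) ∷ (a≢b ∷ a≢v ∷ []) ∷ (b≢v ∷ []) ∷ _)
    x≢y (x∈ , y∈) = go x≢y x∈ y∈
    where
    x∉vg : ∀ {x} → x ≡ a ⊎ x ≡ b → x ∉ pair v g
    x∉vg x∈ = ∉pair (either≢ x∈ a≢v b≢v) (either≢ x∈ (≢-sym g≢a) (≢-sym g≢b))
    go : ∀ {x y} → x ≢ y → x ≡ a ⊎ x ≡ b → y ∈ₗ a ∷ b ∷ v ∷ [] →
         Identifies (fan-search a b (v ∷ []) g) (pair x y) 2
    go _ (inj₁ refl) (there (there (here refl))) =
      via-positive (inj₂ (x∈pair v g)) (via-positive (inj₁ (x∈pair a g)) (identifies-output 0 refl))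
    go _ (inj₂ refl) (there (there (here refl))) = via-positive (inj₂ (x∈pair v g))
      (via-negative (∉pair (≢-sym a≢b) (≢-sym g≢b)) (∉pair (≢-sym a≢v) (≢-sym g≢v)) (identifies-output 0 refl))
    go x≢y x∈ (here refl) =
      via-negative (x∉vg x∈) (∉pair a≢v (≢-sym g≢a)) (identifies-output 1 (pair-≡ x≢y x∈ (inj₁ refl)))
    go x≢y x∈ (there (here refl)) =
      via-negative (x∉vg x∈) (∉pair b≢v (≢-sym g≢b)) (identifies-output 1 (pair-≡ x≢y x∈ (inj₂ refl)))
  fan-search-identifies (v₁ ∷ v₂ ∷ W) u =
    let u-grid , v₁≢W , v₂≢W , u-rest = unique-fan-step u in
    fan-step-identifies u-grid v₁≢W v₂≢W (ℕ.m≤n+m 2 _) (fan-search-identifies W u-rest)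

  split-identifies : ∀ {a b : Fin n} {L F G m} → All (a ≢_) L → All (b ≢_) L →
    IdentifiesFan F a b L m → IdentifiesWithin G L m →
    IdentifiesWithin (test (pair a b) F G) (a ∷ b ∷ L) (suc m)
  split-identifies {a} {b} a≢L b≢L F-identifies G-identifies = go
    where
    go : IdentifiesWithin (test (pair a b) _ _) (a ∷ b ∷ _) _
    go x≢y (here refl) y∈ = via-positive (inj₁ (x∈pair a b)) (F-identifies x≢y (inj₁ refl , y∈))
    go x≢y (there (here refl)) y∈ = via-positive (inj₁ (y∈pair a b)) (F-identifies x≢y (inj₂ refl , y∈))
    go x≢y (there (there x∈L)) (here refl) =
      identifies-swap (via-positive (inj₁ (x∈pair a b)) (F-identifies (≢-sym x≢y) (inj₁ refl , there (there x∈L))))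
    go x≢y (there (there x∈L)) (there (here refl)) =
      identifies-swap (via-positive (inj₁ (y∈pair a b)) (F-identifies (≢-sym x≢y) (inj₂ refl , there (there x∈L))))
    go x≢y (there (there x∈L)) (there (there y∈L)) =
      via-negative (∉pair (All≢⇒≢ a≢L x∈L) (All≢⇒≢ b≢L x∈L)) (∉pair (All≢⇒≢ a≢L y∈L) (All≢⇒≢ b≢L y∈L))
        (G-identifies x≢y x∈L y∈L)

  within-search : List (Fin n) → Fin n → Algorithm n
  within-search (a ∷ b ∷ c ∷ W) g = test (pair a b) (fan-search a b (c ∷ W) g) (within-search (c ∷ W) g)
  within-search (a ∷ b ∷ []) g = output (pair a b)
  within-search _ g = output ⁅ g ⁆   -- fewer than two items: does not occur

  within-search-size : ∀ {g : Fin n} L → Unique (g ∷ L) → TestSize 2 (within-search L g)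
  within-search-size (a ∷ b ∷ c ∷ W) ((g≢a ∷ g≢b ∷ g≢W) ∷ (a≢b ∷ a≢W) ∷ b≢W ∷ W!) =
    pair-test-size a≢b (fan-search-size (c ∷ W) ((g≢a ∷ g≢b ∷ g≢W) ∷ (a≢b ∷ a≢W) ∷ b≢W ∷ W!))
                      (within-search-size (c ∷ W) (g≢W ∷ W!))
  within-search-size (a ∷ b ∷ []) _ = output _
  within-search-size (a ∷ []) _ = output _
  within-search-size [] _ = output _

  within-search-identifies : ∀ {g : Fin n} L → Unique (g ∷ L) →
                             IdentifiesWithin (within-search L g) L (⌊ length L /2⌋ + 2)
  within-search-identifies (a ∷ b ∷ c ∷ W) u@((g≢a ∷ g≢b ∷ g≢W) ∷ (a≢b ∷ a≢W) ∷ b≢W ∷ W!) =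
    split-identifies a≢W b≢W (fan-search-identifies (c ∷ W) u) (within-search-identifies (c ∷ W) (g≢W ∷ W!))
  within-search-identifies (a ∷ b ∷ []) _ x≢y x∈ y∈ = identifies-output _ (pair-≡ x≢y (two x∈) (two y∈))
    where
    two : ∀ {z} → z ∈ₗ a ∷ b ∷ [] → z ≡ a ⊎ z ≡ b
    two (here e) = inj₁ e
    two (there (here e)) = inj₂ e
  within-search-identifies (a ∷ []) _ x≢y (here refl) (here refl) = ⊥-elim (x≢y refl)

  -- After a positive answer for {a , b}, the item v₃ is good if {v₁ , v₂} is positive too,
  -- and v₁ is good otherwise.  (Shorter lists do not occur.)
  search : List (Fin n) → Algorithm n
  search (a ∷ b ∷ v₁ ∷ v₂ ∷ v₃ ∷ W) =
    test (pair a b) (fan-step a b v₁ v₂ v₃ (fan-search a b (v₃ ∷ W) v₁)) (within-search (v₁ ∷ v₂ ∷ v₃ ∷ W) a)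
  search _ = output ⊤

  module _ {a b v₁ v₂ v₃ : Fin n} {W : List (Fin n)} where

    unique-search : Unique (a ∷ b ∷ v₁ ∷ v₂ ∷ v₃ ∷ W) →
      Unique (v₃ ∷ a ∷ b ∷ v₁ ∷ v₂ ∷ []) × All (v₁ ≢_) (v₃ ∷ W) × All (v₂ ≢_) (v₃ ∷ W) ×
      Unique (v₁ ∷ a ∷ b ∷ v₃ ∷ W) × Unique (a ∷ v₁ ∷ v₂ ∷ v₃ ∷ W) × All (b ≢_) (v₁ ∷ v₂ ∷ v₃ ∷ W)
    unique-search ((a≢b ∷ a≢v₁ ∷ a≢v₂ ∷ a≢v₃ ∷ a≢W) ∷ b≢L@(b≢v₁ ∷ b≢v₂ ∷ b≢v₃ ∷ b≢W) ∷
                   (v₁≢v₂ ∷ v₁≢v₃ ∷ v₁≢W) ∷ (v₂≢v₃ ∷ v₂≢W) ∷ v₃≢W ∷ W!) =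
      ((≢-sym a≢v₃ ∷ ≢-sym b≢v₃ ∷ ≢-sym v₁≢v₃ ∷ ≢-sym v₂≢v₃ ∷ []) ∷ (a≢b ∷ a≢v₁ ∷ a≢v₂ ∷ []) ∷
       (b≢v₁ ∷ b≢v₂ ∷ []) ∷ (v₁≢v₂ ∷ []) ∷ [] ∷ []) ,
      (v₁≢v₃ ∷ v₁≢W) , (v₂≢v₃ ∷ v₂≢W) ,
      ((≢-sym a≢v₁ ∷ ≢-sym b≢v₁ ∷ v₁≢v₃ ∷ v₁≢W) ∷ (a≢b ∷ a≢v₃ ∷ a≢W) ∷ (b≢v₃ ∷ b≢W) ∷ v₃≢W ∷ W!) ,
      ((a≢v₁ ∷ a≢v₂ ∷ a≢v₃ ∷ a≢W) ∷ (v₁≢v₂ ∷ v₁≢v₃ ∷ v₁≢W) ∷ (v₂≢v₃ ∷ v₂≢W) ∷ v₃≢W ∷ W!) ,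
      b≢L

    search-size : Unique (a ∷ b ∷ v₁ ∷ v₂ ∷ v₃ ∷ W) → TestSize 2 (search (a ∷ b ∷ v₁ ∷ v₂ ∷ v₃ ∷ W))
    search-size u@((a≢b ∷ _) ∷ _) =
      let u-grid , _ , _ , u-fan , u-within , _ = unique-search u in
      pair-test-size a≢b (fan-step-size u-grid (fan-search-size (v₃ ∷ W) u-fan))
                         (within-search-size (v₁ ∷ v₂ ∷ v₃ ∷ W) u-within)

    search-identifies : Unique (a ∷ b ∷ v₁ ∷ v₂ ∷ v₃ ∷ W) →
      IdentifiesWithin (search (a ∷ b ∷ v₁ ∷ v₂ ∷ v₃ ∷ W)) (a ∷ b ∷ v₁ ∷ v₂ ∷ v₃ ∷ W) (⌊ 5 + length W /2⌋ + 2)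
    search-identifies u@(a≢L ∷ _) =
      let u-grid , v₁≢ , v₂≢ , u-fan , u-within , b≢L = unique-search u in
      split-identifies (All.tail a≢L) b≢L
        (fan-step-identifies u-grid v₁≢ v₂≢ (ℕ.m≤n+m 2 _) (fan-search-identifies (v₃ ∷ W) u-fan))
        (within-search-identifies (v₁ ∷ v₂ ∷ v₃ ∷ W) u-within)

search-upper-bound : ∀ n → 5 ≤ n → TestSize 2 (search (allFin n)) × Solves 2 (search (allFin n)) ×
                     UsesAtMost 2 (search (allFin n)) (⌊ n /2⌋ + 2)
search-upper-bound n (s≤s (s≤s (s≤s (s≤s (s≤s _))))) =
  search-size (allFin⁺ n) ,
  (λ D ∣D∣≡2 → Identifies.correct (identifies D ∣D∣≡2)) ,
  (λ D ∣D∣≡2 → Identifies.cost≤ (identifies D ∣D∣≡2))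
  where
  identifies : ∀ D → ∣ D ∣ ≡ 2 → Identifies (search (allFin n)) D (⌊ n /2⌋ + 2)
  identifies D ∣D∣≡2 with ∣p∣≡2⇒pair D ∣D∣≡2
  ... | x , y , x≢y , refl =
    subst (Identifies _ _) (cong (λ w → ⌊ 5 + w /2⌋ + 2) (length-tabulate _))
      (search-identifies (allFin⁺ n) x≢y (∈-allFin x) (∈-allFin y))

search-lower-bound : ∀ n → 5 ≤ n → ∀ (A : Algorithm n) m → TestSize 2 A → Solves 2 A → UsesAtMost 2 A m →
                     ⌊ n /2⌋ + 2 ≤ m
search-lower-bound n 5≤n A m size-2 solves uses =
  subst (_≤ m) bound≡ (adversary-lower-bound (adversary n) A size-2 solves uses (within ⊤) 1≤bound)
  where
  bound≡ : withinBound ∣ ⊤ {n} ∣ ≡ ⌊ n /2⌋ + 2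
  bound≡ = trans (cong withinBound (∣⊤∣≡n n)) (withinBound≡⌊n/2⌋+2 n 5≤n)
  1≤bound : 1 ≤ withinBound ∣ ⊤ {n} ∣
  1≤bound = subst (1 ≤_) (sym bound≡) (≤-trans (s≤s z≤n) (ℕ.m≤n+m 2 _))

theorem2 : IsM 2 2 3 ∞
           × IsM 2 2 4 (fin 5)
           × (∀ (n : ℕ) → 5 ≤ n → IsM 2 2 n (fin (n / 2 + 2)))
theorem2 = M[2,2,3]≡∞ , M[2,2,4]≡5 , M[2,2,n]
  where
  M[2,2,n] : ∀ n → 5 ≤ n → IsM 2 2 n (fin (n / 2 + 2))
  M[2,2,n] n 5≤n rewrite n/2≡⌊n/2⌋ n =
    (search (allFin n) , search-upper-bound n 5≤n) , search-lower-bound n 5≤n
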